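{- Let $q\ge 5$ be such that $p=2^q-1$ is a Mersenne prime, and let $E_q$ be the elliptic curve over $\mathbb{Q}$ defined by $y^2=x(x+1)(x+2^q)$. Then $E_q$ has split multiplicative reduction at $2$, non-split multiplicative reduction at $p$, and good reduction at all other primes.
   Context: A Mersenne prime is a prime of the form $2^q-1$ with $q$ a prime. -}

module Defs where

open import Data.Nat as ℕ using (ℕ; _^_)
open import Data.Integer as Z using (ℤ; +_)
open import Data.Integer.Divisibility using (_∣_)
open import Data.Rational as Q using (ℚ; _/_; 0ℚ)
open import Data.Product using (Σ; ∃; ∃-syntax; _×_)
open import Relation.Binary.PropositionalEquality using (_≡_)
open import Relation.Nullary using (¬_)

-- An integral Weierstrass model
--   y^2 + a1 x y + a3 y = x^3 + a2 x^2 + a4 x + a6 ,  a_i ∈ ℤ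
record WModel : Set where
  constructor mkW
  field
    a1 a2 a3 a4 a6 : ℤ
open WModel public

-- Standard invariants (Silverman III.1)
module _ (E : WModel) where
  open Z using (_+_; _*_; _-_; -_)
  b2 b4 b6 b8 Δ : ℤ
  b2 = a1 E * a1 E + + 4 * a2 E
  b4 = + 2 * a4 E + a1 E * a3 E
  b6 = a3 E * a3 E + + 4 * a6 E
  b8 = a1 E * a1 E * a6 E + + 4 * a2 E * a6 E - a1 E * a3 E * a4 E
       + a2 E * a3 E * a3 E - a4 E * a4 E
  Δ = - (b2 * b2 * b8) - + 8 * (b4 * b4 * b4) - + 27 * (b6 * b6)
      + + 9 * (b2 * b4 * b6)

⟦_⟧ : ℤ → ℚ
⟦ z ⟧ = z / 1

-- E and E' are isomorphic over ℚ: related by an admissible change of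
-- variables x = u^2 x' + r , y = u^3 y' + s u^2 x' + t with u ≠ 0
-- (Silverman Table III.1.2, written without division).
_≅ℚ_ : WModel → WModel → Set
E ≅ℚ E' = ∃[ u ] ∃[ r ] ∃[ s ] ∃[ t ] (¬ (u ≡ 0ℚ) ×
    (u * ⟦ a1 E' ⟧ ≡ ⟦ a1 E ⟧ + ⟦ + 2 ⟧ * s) ×
    (u * u * ⟦ a2 E' ⟧ ≡ ⟦ a2 E ⟧ - s * ⟦ a1 E ⟧ + ⟦ + 3 ⟧ * r - s * s) ×
    (u * u * u * ⟦ a3 E' ⟧ ≡ ⟦ a3 E ⟧ + r * ⟦ a1 E ⟧ + ⟦ + 2 ⟧ * t) ×
    (u * u * u * u * ⟦ a4 E' ⟧ ≡ ⟦ a4 E ⟧ - s * ⟦ a3 E ⟧ + ⟦ + 2 ⟧ * r * ⟦ a2 E ⟧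
        - (t + r * s) * ⟦ a1 E ⟧ + ⟦ + 3 ⟧ * r * r - ⟦ + 2 ⟧ * s * t) ×
    (u * u * u * u * u * u * ⟦ a6 E' ⟧ ≡ ⟦ a6 E ⟧ + r * ⟦ a4 E ⟧ + r * r * ⟦ a2 E ⟧
        + r * r * r - t * ⟦ a3 E ⟧ - t * t - r * t * ⟦ a1 E ⟧))
  where open Q using (_+_; _*_; _-_)

infix 4 _≡_[mod_]
_≡_[mod_] : ℤ → ℤ → ℕ → Set
x ≡ y [mod p ] = (+ p) ∣ (x Z.- y)

-- E is minimal at p: among all integral models isomorphic over ℚ,
-- v_p(Δ) is least, i.e. every power of p dividing Δ(E) divides Δ(E').
MinimalAt : ℕ → WModel → Set
MinimalAt p E = ∀ E' → E ≅ℚ E' → ∀ k → (+ (p ^ k)) ∣ Δ E → (+ (p ^ k)) ∣ Δ E'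

module _ (p : ℕ) (E : WModel) where
  open Z using (_+_; _*_; _-_; -_)
  -- (x0 , y0) is a singular point of the reduction of E mod p:
  -- F = y^2 + a1 x y + a3 y - x^3 - a2 x^2 - a4 x - a6 and its two
  -- partial derivatives vanish mod p.
  SingularPt : ℤ → ℤ → Set
  SingularPt x0 y0 =
    (y0 * y0 + a1 E * x0 * y0 + a3 E * y0
       ≡ x0 * x0 * x0 + a2 E * x0 * x0 + a4 E * x0 + a6 E [mod p ]) ×
    (a1 E * y0 ≡ + 3 * x0 * x0 + + 2 * a2 E * x0 + a4 E [mod p ]) ×
    (+ 2 * y0 + a1 E * x0 + a3 E ≡ + 0 [mod p ])

  -- At a singular point (x0,y0), the tangent cone is
  --   Y^2 + a1 X Y - (3 x0 + a2) X^2 = 0 .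
  -- It is a node iff this quadratic form has nonzero discriminant mod p,
  -- and the node is split iff its tangent slopes lie in F_p.
  NodeAt : ℤ → ℤ → Set
  NodeAt x0 y0 = SingularPt x0 y0 ×
    ¬ (a1 E * a1 E + + 4 * (+ 3 * x0 + a2 E) ≡ + 0 [mod p ])

  RationalTangents : ℤ → Set
  RationalTangents x0 = ∃[ m ] (m * m + a1 E * m ≡ + 3 * x0 + a2 E [mod p ])

GoodReduction : ℕ → WModel → Set
GoodReduction p E = ∃[ E' ] (E ≅ℚ E' × MinimalAt p E' × ¬ ((+ p) ∣ Δ E'))

SplitMultiplicative : ℕ → WModel → Set
SplitMultiplicative p E = ∃[ E' ] (E ≅ℚ E' × MinimalAt p E' ×
  ∃[ x0 ] ∃[ y0 ] (NodeAt p E' x0 y0 × RationalTangents p E' x0))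

NonSplitMultiplicative : ℕ → WModel → Set
NonSplitMultiplicative p E = ∃[ E' ] (E ≅ℚ E' × MinimalAt p E' ×
  ∃[ x0 ] ∃[ y0 ] (NodeAt p E' x0 y0 × ¬ RationalTangents p E' x0))

-- E_q : y^2 = x (x+1) (x+2^q) = x^3 + (1+2^q) x^2 + 2^q x
Eq : ℕ → WModel
Eq q = mkW (+ 0) (+ (1 ℕ.+ 2 ^ q)) (+ 0) (+ (2 ^ q)) (+ 0)

module Submission where

-- Write A = 2^q, so that Eq q is y² = x(x + 1)(x + A), with Δ = 16A²(A - 1)² and
-- c₄ = 16(A² - A + 1).  At a prime ℓ ∤ 2A(A - 1) the discriminant is a unit, so the
-- model is minimal with good reduction.  At p = A - 1 the model is minimal because
-- p ∤ c₄; modulo p it becomes y² = x(x + 1)², whose node at (-1, 0) has tangent slopes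
-- m with m² ≡ -1, impossible since p ≡ 3 (mod 4).  At 2, as 32 ∣ A, the substitution
-- x = 4x′, y = 8y′ + 4x′ gives an integral model with odd c₄ reducing to y² + xy = x³,
-- a node with the rational tangents y = 0 and y = x.
--
-- Minimality when ℓ ∤ c₄: an isomorphism with scaling u = n/d (in lowest terms) gives
-- c₄′n⁴ = c₄d⁴ and Δ′n¹² = Δd¹², so ℓ ∤ n and every power of ℓ dividing Δ divides Δ′.
-- These two relations come from polynomial identities over ℚ: c₄ and c₆ are unchanged
-- by translations and have weights 4 and 6, and 1728Δ = c₄³ - c₆².


open import Defs
open import Data.Nat as ℕ using (ℕ; zero; suc; _∸_; _≤_; _<_; s≤s; z≤n; _!)
open import Data.Nat.Properties
open import Data.Nat.Divisibility
open import Data.Nat.Primality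
  using (Prime; euclidsLemma; prime⇒nonZero; prime⇒nonTrivial; prime[2]; prime⇒irreducible)
import Data.Nat.Coprimality as Coprimality
open import Data.Nat.Combinatorics using (_C_; nCn≡1; nCk≡n!/k![n-k]!; k![n∸k]!∣n!)
open import Data.Nat.DivMod using (m/n*n≡m)
open import Data.Nat.Tactic.RingSolver using (solve-∀)
open import Data.Fin as Fin using (Fin; toℕ; inject₁; fromℕ)
open import Data.Fin.Properties using (toℕ-fromℕ; toℕ-inject₁; toℕ<n)
open import Data.Integer as ℤ using (ℤ; +_; -[1+_]; +0; +[1+_])
import Data.Integer.Properties as ℤP
open import Data.Integer.Divisibility using () renaming (_∣_ to _∣ᶻ_)
import Data.Integer.Divisibility.Signed as ℤ∣
import Data.Integer.Solver as ℤSolver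
open import Data.Rational as Q using (ℚ; mkℚ; ↥_; ↧_; ↧ₙ_; toℚᵘ)
import Data.Rational.Properties as QP
import Data.Rational.Solver as QSolver
import Data.Rational.Unnormalised as ℚᵘ
import Data.Rational.Unnormalised.Properties as ℚᵘP
open import Data.Product using (∃-syntax; _×_; _,_)
open import Data.Sum using ([_,_]′; inj₁; inj₂)
open import Data.Empty using (⊥-elim)
open import Function using (id; _∘_)
open import Level using (0ℓ)
open import Relation.Nullary using (¬_; contradiction)
open import Relation.Binary.PropositionalEquality
open import Algebra.Bundles using (CommutativeRing)
open import Algebra.Bundles.Raw using (RawRing)
import Algebra.Definitions.RawMonoid as RawMonoid
import Algebra.Definitions.RawSemiring as RawSemiring
import Algebra.Properties.CommutativeSemiring.Binomial as Binomial
import Algebra.Properties.CommutativeSemiring.Exp as Exp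
import Algebra.Properties.Monoid.Sum as Sum

-- Primes

module _ where
  open import Data.Nat using (_+_; _*_; _^_)

  n∣n! : ∀ n → .{{ℕ.NonZero n}} → n ∣ n !
  n∣n! (suc n) = m∣m*n (n !)

  module _ {p : ℕ} (p-prime : Prime p) where

    private instance
      p≢0 = prime⇒nonZero p-prime

    prime∤1 : p ∤ 1
    prime∤1 p∣1 = ℕ.nonTrivial⇒≢1 {{prime⇒nonTrivial p-prime}} (∣1⇒≡1 p∣1)

    prime∣prime⇒≡ : ∀ {q} → Prime q → p ∣ q → p ≡ q
    prime∣prime⇒≡ q-prime p∣q =
      [ ⊥-elim ∘ ℕ.nonTrivial⇒≢1 {{prime⇒nonTrivial p-prime}} , id ]′ (prime⇒irreducible q-prime p∣q)

    prime∤* : ∀ {m n} → p ∤ m → p ∤ n → p ∤ m * n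
    prime∤* {m} {n} p∤m p∤n = [ p∤m , p∤n ]′ ∘ euclidsLemma m n p-prime

    prime∣^⇒∣ : ∀ m n → p ∣ m ^ n → p ∣ m
    prime∣^⇒∣ m zero    p∣1    = contradiction p∣1 prime∤1
    prime∣^⇒∣ m (suc n) p∣mⁿ⁺¹ =
      [ id , prime∣^⇒∣ m n ]′ (euclidsLemma m (m ^ n) p-prime p∣mⁿ⁺¹)

    prime^∣*⇒∣ : ∀ {m} → p ∤ m → ∀ k n → p ^ k ∣ n * m → p ^ k ∣ n
    prime^∣*⇒∣ p∤m zero n _ = 1∣ n
    prime^∣*⇒∣ {m} p∤m (suc k) n pᵏ⁺¹∣nm
      with euclidsLemma n m p-prime (∣-trans (m∣m*n (p ^ k)) pᵏ⁺¹∣nm)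
    ... | inj₂ p∣m = contradiction p∣m p∤m
    ... | inj₁ (divides n′ refl) =
      subst (p ^ suc k ∣_) (*-comm p n′) (*-monoʳ-∣ p pᵏ∣n′)
      where
      pᵏ∣n′ : p ^ k ∣ n′
      pᵏ∣n′ = prime^∣*⇒∣ p∤m k n′ (*-cancelˡ-∣ p
        (subst (p ^ suc k ∣_) (trans (cong (_* m) (*-comm n′ p)) (*-assoc p n′ m)) pᵏ⁺¹∣nm))

    prime∤! : ∀ n → n < p → p ∤ n !
    prime∤! zero    _   = prime∤1
    prime∤! (suc n) n<p =
      [ <⇒≱ n<p ∘ ∣⇒≤ , prime∤! n (<-trans (n<1+n n) n<p) ]′ ∘ euclidsLemma (suc n) (n !) p-prime

    prime∣pCk : ∀ k → 0 < k → k < p → p ∣ p C k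
    prime∣pCk k 0<k k<p =
      [ id , ⊥-elim ∘ prime∤* (prime∤! k k<p) (prime∤! (p ∸ k) (∸-monoʳ-< 0<k (<⇒≤ k<p))) ]′
        (euclidsLemma (p C k) (k ! * (p ∸ k) !) p-prime (subst (p ∣_) (sym C*!*!≡!) (n∣n! p)))
      where
      instance _ = k !* (p ∸ k) !≢0
      C*!*!≡! : (p C k) * (k ! * (p ∸ k) !) ≡ p !
      C*!*!≡! = trans (cong (_* (k ! * (p ∸ k) !)) (nCk≡n!/k![n-k]! (<⇒≤ k<p)))
                      (m/n*n≡m (k![n∸k]!∣n! (<⇒≤ k<p)))

-- Fermat's little theorem; -1 is not a square modulo p ≡ 3 (mod 4)

  open Sum +-0-monoid using (sum; sum-init-last; sum-cong-≗)

  ∣-sum : ∀ {d n} (f : Fin n → ℕ) → (∀ i → d ∣ f i) → d ∣ sum f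
  ∣-sum {d} {zero}  f d∣f = d ∣0
  ∣-sum {d} {suc n} f d∣f = ∣m∣n⇒∣m+n (d∣f Fin.zero) (∣-sum (f ∘ Fin.suc) (d∣f ∘ Fin.suc))

  binomial-theorem : ∀ m n → (m + 1) ^ n ≡ sum (λ (k : Fin (suc n)) → (n C toℕ k) * m ^ toℕ k)
  binomial-theorem m n =
    trans (sym (^′≡^ (m + 1) n)) (trans (Binomial.theorem +-*-commutativeSemiring n m 1) (sum-cong-≗ term≡))
    where
    open RawSemiring ℕ.+-*-rawSemiring using () renaming (_^_ to _^′_)
    open RawMonoid ℕ.+-0-rawMonoid using () renaming (_×_ to _×′_)
    ^′≡^ : ∀ x k → x ^′ k ≡ x ^ k
    ^′≡^ x zero    = refl
    ^′≡^ x (suc k) = cong (x *_) (^′≡^ x k)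
    ×′≡* : ∀ k x → k ×′ x ≡ k * x
    ×′≡* zero    x = refl
    ×′≡* (suc k) x = cong (_+_ x) (×′≡* k x)
    term≡ : ∀ k → Binomial.binomialTerm +-*-commutativeSemiring m 1 n k ≡ (n C toℕ k) * m ^ toℕ k
    term≡ k = trans (×′≡* (n C toℕ k) _) (cong ((n C toℕ k) *_)
      (trans (cong₂ _*_ (^′≡^ m (toℕ k)) (trans (^′≡^ 1 (n ∸ toℕ k)) (^-zeroˡ (n ∸ toℕ k))))
             (*-identityʳ (m ^ toℕ k))))

  module _ {n : ℕ} (p-prime : Prime (suc n)) where

    private
      p = suc n

    freshman's-dream : ∀ m → ∃[ k ] (m + 1) ^ p ≡ 1 + (k * p + m ^ p)
    freshman's-dream m = _∣_.quotient p∣middle , (begin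
      (m + 1) ^ p                                               ≡⟨ binomial-theorem m p ⟩
      1 + sum (f ∘ Fin.suc)                                     ≡⟨ cong (_+_ 1) (sum-init-last (f ∘ Fin.suc)) ⟩
      1 + (sum (f ∘ Fin.suc ∘ inject₁) + f (Fin.suc (fromℕ n))) ≡⟨ cong₂ (λ a b → 1 + (a + b)) (_∣_.equality p∣middle) last≡ ⟩
      1 + (_∣_.quotient p∣middle * p + m ^ p)                   ∎)
      where
      open ≡-Reasoning
      f : Fin (suc p) → ℕ
      f k = (p C toℕ k) * m ^ toℕ k
      p∣middle : p ∣ sum (f ∘ Fin.suc ∘ inject₁)
      p∣middle = ∣-sum (f ∘ Fin.suc ∘ inject₁) (λ i → ∣-trans (prime∣pCk p-prime (suc (toℕ (inject₁ i))) (s≤s z≤n)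
        (s≤s (subst (_< n) (sym (toℕ-inject₁ i)) (toℕ<n i)))) (m∣m*n _))
      last≡ : f (Fin.suc (fromℕ n)) ≡ m ^ p
      last≡ rewrite toℕ-fromℕ n = trans (cong (_* m ^ p) (nCn≡1 p)) (*-identityˡ (m ^ p))

    fermat : ∀ m → ∃[ k ] m ^ p ≡ m + k * p
    fermat zero    = 0 , refl
    fermat (suc m) with fermat m | freshman's-dream m
    ... | k , mᵖ≡ | j , [m+1]ᵖ≡ = j + k , (begin
      suc m ^ p                  ≡⟨ cong (_^ p) (+-comm 1 m) ⟩
      (m + 1) ^ p                ≡⟨ [m+1]ᵖ≡ ⟩
      1 + (j * p + m ^ p)        ≡⟨ cong (λ x → 1 + (j * p + x)) mᵖ≡ ⟩
      1 + (j * p + (m + k * p))  ≡⟨ regroup j k m p ⟩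
      suc m + (j + k) * p        ∎)
      where
      open ≡-Reasoning
      regroup : ∀ j k m p → 1 + (j * p + (m + k * p)) ≡ suc m + (j + k) * p
      regroup = solve-∀

  m+1∣m*[m*m]^g+1 : ∀ m g → m + 1 ∣ m * (m * m) ^ g + 1
  m+1∣m*[m*m]^g+1 m zero    = ∣-reflexive (cong (_+ 1) (sym (*-identityʳ m)))
  m+1∣m*[m*m]^g+1 m (suc g) = ∣m+n∣m⇒∣n
    (subst (m + 1 ∣_) (sym (regroup m ((m * m) ^ g)))
      (∣m∣n⇒∣m+n (∣-trans (m+1∣m*[m*m]^g+1 m g) (n∣m*n (m * m))) ∣-refl))
    (n∣m*n m)
    where
    regroup : ∀ m y → m * (m + 1) + (m * ((m * m) * y) + 1) ≡ (m * m) * (m * y + 1) + (m + 1)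
    regroup = solve-∀

  m^[4g+3]≡m*m²*[m⁴]^g : ∀ m g → m ^ (4 * g + 3) ≡ m * ((m * m) * ((m * m) * (m * m)) ^ g)
  m^[4g+3]≡m*m²*[m⁴]^g m g = begin
    m ^ (4 * g + 3)                         ≡⟨ cong (m ^_) (+-comm (4 * g) 3) ⟩
    m ^ (3 + 4 * g)                         ≡⟨ ^-distribˡ-+-* m 3 (4 * g) ⟩
    m ^ 3 * m ^ (4 * g)                     ≡⟨ cong (m ^ 3 *_) (^-*-assoc m 4 g) ⟨
    m ^ 3 * (m ^ 4) ^ g                     ≡⟨ cong (λ x → m ^ 3 * x ^ g) (m^4≡ m) ⟩
    m ^ 3 * ((m * m) * (m * m)) ^ g         ≡⟨ m^3*y≡ m _ ⟩
    m * ((m * m) * ((m * m) * (m * m)) ^ g) ∎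
    where
    open ≡-Reasoning
    -- the powers are unfolded by hand: the ring solver does not read ℕ's _^_
    m^4≡ : ∀ m → m * (m * (m * (m * 1))) ≡ (m * m) * (m * m)
    m^4≡ = solve-∀
    m^3*y≡ : ∀ m y → m * (m * (m * 1)) * y ≡ m * ((m * m) * y)
    m^3*y≡ = solve-∀

  -- If m² ≡ -1 then m^(p-1) = (m²)^(2g+1) ≡ -1, against Fermat; the divisibility
  -- m² + 1 ∣ (m²)^(2g+1) + 1 keeps the argument inside ℕ.
  prime≡3mod4⇒∤m*m+1 : ∀ {p} g → Prime p → p ≡ 4 * g + 3 → ∀ m → p ∤ m * m + 1
  prime≡3mod4⇒∤m*m+1 {zero}  g ()
  prime≡3mod4⇒∤m*m+1 {suc n} g p-prime p≡4g+3 m p∣m²+1 with fermat p-prime m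
  ... | k , mᵖ≡ = [ p∤2 , p∤m ]′ (euclidsLemma 2 m p-prime p∣2m)
    where
    p = suc n
    T = (m * m) * ((m * m) * (m * m)) ^ g + 1
    mT≡ : m * T ≡ k * p + 2 * m
    mT≡ = begin
      m * T                                           ≡⟨ *-distribˡ-+ m _ 1 ⟩
      m * ((m * m) * ((m * m) * (m * m)) ^ g) + m * 1 ≡⟨ cong₂ _+_ (sym (m^[4g+3]≡m*m²*[m⁴]^g m g)) (*-identityʳ m) ⟩
      m ^ (4 * g + 3) + m                             ≡⟨ cong (λ e → m ^ e + m) (sym p≡4g+3) ⟩
      m ^ p + m                                       ≡⟨ cong (_+ m) mᵖ≡ ⟩
      m + k * p + m                                   ≡⟨ regroup m (k * p) ⟩
      k * p + 2 * m                                   ∎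
      where
      open ≡-Reasoning
      regroup : ∀ m x → m + x + m ≡ x + 2 * m
      regroup = solve-∀
    p∣2m : p ∣ 2 * m
    p∣2m = ∣m+n∣m⇒∣n
      (subst (p ∣_) mT≡ (∣-trans (∣-trans p∣m²+1 (m+1∣m*[m*m]^g+1 (m * m) g)) (n∣m*n m)))
      (n∣m*n k)
    p∤2 : p ∤ 2
    p∤2 p∣2 = <⇒≱ (subst (2 <_) (sym p≡4g+3) (m≤n+m 3 (4 * g))) (∣⇒≤ p∣2)
    p∤m : p ∤ m
    p∤m p∣m = prime∤1 p-prime (∣m+n∣m⇒∣n p∣m²+1 (∣-trans p∣m (m∣m*n m)))

  prime∤-cross-multiplied : ∀ {ℓ} n d c c′ → Prime ℓ → Coprimality.Coprime n d →
    c′ * n ^ 4 ≡ c * d ^ 4 → ℓ ∤ c → ℓ ∤ n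
  prime∤-cross-multiplied {ℓ} n d c c′ ℓ-prime n⊥d eq ℓ∤c ℓ∣n =
    [ ℓ∤c , ℓ∤d ∘ prime∣^⇒∣ ℓ-prime d 4 ]′ (euclidsLemma c (d ^ 4) ℓ-prime ℓ∣cd⁴)
    where
    ℓ∣cd⁴ : ℓ ∣ c * d ^ 4
    ℓ∣cd⁴ = subst (ℓ ∣_) eq (∣-trans (∣-trans ℓ∣n (m∣m*n (n ^ 3))) (n∣m*n c′))
    ℓ∤d : ℓ ∤ d
    ℓ∤d ℓ∣d = prime∤1 ℓ-prime (subst (ℓ ∣_) (n⊥d (ℓ∣n , ℓ∣d)) ∣-refl)

  prime-power-∣-cross-multiplied : ∀ {ℓ} n d D D′ j → Prime ℓ → ℓ ∤ n →
    D′ * n ^ j ≡ D * d ^ j → ∀ k → ℓ ^ k ∣ D → ℓ ^ k ∣ D′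
  prime-power-∣-cross-multiplied {ℓ} n d D D′ j ℓ-prime ℓ∤n eq k ℓᵏ∣D =
    prime^∣*⇒∣ ℓ-prime (ℓ∤n ∘ prime∣^⇒∣ ℓ-prime n j) k D′
      (subst (ℓ ^ k ∣_) (sym eq) (∣-trans ℓᵏ∣D (m∣m*n (d ^ j))))

-- The embedding ℤ → ℚ

⟦⟧≡mkℚ : ∀ z → ⟦ z ⟧ ≡ mkℚ z 0 (Coprimality.sym (Coprimality.1-coprimeTo ℤ.∣ z ∣))
⟦⟧≡mkℚ (+ n)    = QP.normalize-coprime (Coprimality.sym (Coprimality.1-coprimeTo n))
⟦⟧≡mkℚ -[1+ n ] = cong Q.-_ (QP.normalize-coprime (Coprimality.sym (Coprimality.1-coprimeTo (suc n))))

⟦⟧-injective : ∀ {x y} → ⟦ x ⟧ ≡ ⟦ y ⟧ → x ≡ y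
⟦⟧-injective {x} {y} eq = cong ↥_ (trans (sym (⟦⟧≡mkℚ x)) (trans eq (⟦⟧≡mkℚ y)))

⟦⟧-* : ∀ x y → ⟦ x ℤ.* y ⟧ ≡ ⟦ x ⟧ Q.* ⟦ y ⟧
⟦⟧-* x y = sym (cong₂ Q._*_ (⟦⟧≡mkℚ x) (⟦⟧≡mkℚ y))

⟦⟧-+ : ∀ x y → ⟦ x ℤ.+ y ⟧ ≡ ⟦ x ⟧ Q.+ ⟦ y ⟧
⟦⟧-+ x y = sym (trans (cong₂ Q._+_ (⟦⟧≡mkℚ x) (⟦⟧≡mkℚ y))
  (cong (Q._/ 1) (cong₂ ℤ._+_ (ℤP.*-identityʳ x) (ℤP.*-identityʳ y))))

⟦⟧-neg : ∀ x → ⟦ ℤ.- x ⟧ ≡ Q.- ⟦ x ⟧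
⟦⟧-neg x = trans (⟦⟧≡mkℚ (ℤ.- x)) (trans (mkℚ-neg x) (cong Q.-_ (sym (⟦⟧≡mkℚ x))))
  where
  mkℚ-neg : ∀ x → mkℚ (ℤ.- x) 0 (Coprimality.sym (Coprimality.1-coprimeTo ℤ.∣ ℤ.- x ∣))
                ≡ Q.- mkℚ x 0 (Coprimality.sym (Coprimality.1-coprimeTo ℤ.∣ x ∣))
  mkℚ-neg +0       = refl
  mkℚ-neg +[1+ n ] = refl
  mkℚ-neg -[1+ n ] = refl

module _ where
  open Exp (CommutativeRing.commutativeSemiring QP.+-*-commutativeRing) using (_^_; ^-distrib-*)

  ⟦⟧-^ : ∀ x j → ⟦ x ℤ.^ j ⟧ ≡ ⟦ x ⟧ ^ j
  ⟦⟧-^ x zero    = refl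
  ⟦⟧-^ x (suc j) = trans (⟦⟧-* x (x ℤ.^ j)) (cong (⟦ x ⟧ Q.*_) (⟦⟧-^ x j))

  *⟦↧⟧≡⟦↥⟧ : ∀ u → u Q.* ⟦ ↧ u ⟧ ≡ ⟦ ↥ u ⟧
  *⟦↧⟧≡⟦↥⟧ u@(mkℚ n d-1 _) = QP.toℚᵘ-injective (ℚᵘP.≃-trans (QP.toℚᵘ-homo-* u ⟦ ↧ u ⟧)
    (ℚᵘP.≃-trans cross (ℚᵘP.≃-sym (QP.toℚᵘ-cong (⟦⟧≡mkℚ n)))))
    where
    cross : toℚᵘ u ℚᵘ.* toℚᵘ ⟦ ↧ u ⟧ ℚᵘ.≃ toℚᵘ (mkℚ n 0 (Coprimality.sym (Coprimality.1-coprimeTo ℤ.∣ n ∣)))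
    cross rewrite ⟦⟧≡mkℚ (↧ u) = ℚᵘ.*≡* (trans (ℤP.*-identityʳ (n ℤ.* + suc d-1))
      (cong (n ℤ.*_) (cong +_ (sym (*-identityʳ (suc d-1))))))

  scaled⇒cross-multiplied : ∀ u j X Y → u ^ j Q.* ⟦ X ⟧ ≡ ⟦ Y ⟧ →
    ℤ.∣ X ∣ ℕ.* ℤ.∣ ↥ u ∣ ℕ.^ j ≡ ℤ.∣ Y ∣ ℕ.* ↧ₙ u ℕ.^ j
  scaled⇒cross-multiplied u j X Y eq = begin
    ℤ.∣ X ∣ ℕ.* ℤ.∣ ↥ u ∣ ℕ.^ j  ≡⟨ abs-*^ X (↥ u) ⟨
    ℤ.∣ X ℤ.* ↥ u ℤ.^ j ∣        ≡⟨ cong ℤ.∣_∣ (⟦⟧-injective {X ℤ.* ↥ u ℤ.^ j} {Y ℤ.* ↧ u ℤ.^ j} ⟦X↥ᵘ⟧≡⟦Y↧ᵘ⟧) ⟩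
    ℤ.∣ Y ℤ.* ↧ u ℤ.^ j ∣        ≡⟨ abs-*^ Y (↧ u) ⟩
    ℤ.∣ Y ∣ ℕ.* ↧ₙ u ℕ.^ j       ∎
    where
    open ≡-Reasoning
    open QSolver.+-*-Solver using (solve; _:=_; _:*_)
    abs-*^ : ∀ x y → ℤ.∣ x ℤ.* y ℤ.^ j ∣ ≡ ℤ.∣ x ∣ ℕ.* ℤ.∣ y ∣ ℕ.^ j
    abs-*^ x y = trans (ℤP.abs-* x (y ℤ.^ j)) (cong (ℤ.∣ x ∣ ℕ.*_) (abs-^ y j))
      where
      abs-^ : ∀ y j → ℤ.∣ y ℤ.^ j ∣ ≡ ℤ.∣ y ∣ ℕ.^ j
      abs-^ y zero    = refl
      abs-^ y (suc j) = trans (ℤP.abs-* y (y ℤ.^ j)) (cong (ℤ.∣ y ∣ ℕ.*_) (abs-^ y j))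
    ⟦X↥ᵘ⟧≡⟦Y↧ᵘ⟧ : ⟦ X ℤ.* ↥ u ℤ.^ j ⟧ ≡ ⟦ Y ℤ.* ↧ u ℤ.^ j ⟧
    ⟦X↥ᵘ⟧≡⟦Y↧ᵘ⟧ = begin
      ⟦ X ℤ.* ↥ u ℤ.^ j ⟧                  ≡⟨ trans (⟦⟧-* X _) (cong (⟦ X ⟧ Q.*_) (⟦⟧-^ (↥ u) j)) ⟩
      ⟦ X ⟧ Q.* ⟦ ↥ u ⟧ ^ j                ≡⟨ cong (λ v → ⟦ X ⟧ Q.* v ^ j) (*⟦↧⟧≡⟦↥⟧ u) ⟨
      ⟦ X ⟧ Q.* (u Q.* ⟦ ↧ u ⟧) ^ j        ≡⟨ cong (⟦ X ⟧ Q.*_) (^-distrib-* u ⟦ ↧ u ⟧ j) ⟩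
      ⟦ X ⟧ Q.* (u ^ j Q.* ⟦ ↧ u ⟧ ^ j)    ≡⟨ regroup ⟦ X ⟧ (u ^ j) (⟦ ↧ u ⟧ ^ j) ⟩
      (u ^ j Q.* ⟦ X ⟧) Q.* ⟦ ↧ u ⟧ ^ j    ≡⟨ cong (Q._* ⟦ ↧ u ⟧ ^ j) eq ⟩
      ⟦ Y ⟧ Q.* ⟦ ↧ u ⟧ ^ j                ≡⟨ trans (⟦⟧-* Y _) (cong (⟦ Y ⟧ Q.*_) (⟦⟧-^ (↧ u) j)) ⟨
      ⟦ Y ℤ.* ↧ u ℤ.^ j ⟧                  ∎
      where
      regroup : ∀ x a b → x Q.* (a Q.* b) ≡ (a Q.* x) Q.* b
      regroup = solve 3 (λ x a b → x :* (a :* b) := (a :* x) :* b) refl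

-- Weierstrass invariants over an arbitrary ring

module WeierstrassFormulas (R : RawRing 0ℓ 0ℓ) (⟨_⟩ : ℤ → RawRing.Carrier R) where
  open RawRing R

  infixl 6 _-_
  _-_ : Carrier → Carrier → Carrier
  x - y = x + - y

  Δᵇ : Carrier → Carrier → Carrier → Carrier → Carrier
  Δᵇ b₂ b₄ b₆ b₈ = - (b₂ * b₂ * b₈) - ⟨ + 8 ⟩ * (b₄ * b₄ * b₄) - ⟨ + 27 ⟩ * (b₆ * b₆) + ⟨ + 9 ⟩ * (b₂ * b₄ * b₆)

  c₄ᵇ : Carrier → Carrier → Carrier
  c₄ᵇ b₂ b₄ = b₂ * b₂ - ⟨ + 24 ⟩ * b₄

  c₆ᵇ : Carrier → Carrier → Carrier → Carrier
  c₆ᵇ b₂ b₄ b₆ = - (b₂ * b₂ * b₂) + ⟨ + 36 ⟩ * (b₂ * b₄) - ⟨ + 216 ⟩ * b₆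

  module _ (a₁ a₂ a₃ a₄ a₆ : Carrier) where
    b₂ b₄ b₆ b₈ Δ′ c₄ c₆ : Carrier
    b₂ = a₁ * a₁ + ⟨ + 4 ⟩ * a₂
    b₄ = ⟨ + 2 ⟩ * a₄ + a₁ * a₃
    b₆ = a₃ * a₃ + ⟨ + 4 ⟩ * a₆
    b₈ = a₁ * a₁ * a₆ + ⟨ + 4 ⟩ * a₂ * a₆ - a₁ * a₃ * a₄ + a₂ * a₃ * a₃ - a₄ * a₄
    Δ′ = Δᵇ b₂ b₄ b₆ b₈
    c₄ = c₄ᵇ b₂ b₄
    c₆ = c₆ᵇ b₂ b₄ b₆

    -- F(x, y), its partial derivatives, and the discriminant and slope equation of the
    -- tangent cone Y² + a₁XY - (3x + a₂)X², in the shape used by SingularPt, NodeAt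
    -- and RationalTangents
    module _ (x y : Carrier) where
      F ∂ₓF ∂ᵧF : Carrier
      F   = y * y + a₁ * x * y + a₃ * y - (x * x * x + a₂ * x * x + a₄ * x + a₆)
      ∂ₓF = a₁ * y - (⟨ + 3 ⟩ * x * x + ⟨ + 2 ⟩ * a₂ * x + a₄)
      ∂ᵧF = ⟨ + 2 ⟩ * y + a₁ * x + a₃ - ⟨ + 0 ⟩

    module _ (x : Carrier) where
      tangent-discriminant : Carrier
      tangent-discriminant = a₁ * a₁ + ⟨ + 4 ⟩ * (⟨ + 3 ⟩ * x + a₂) - ⟨ + 0 ⟩

      tangent-slope : Carrier → Carrier
      tangent-slope m = m * m + a₁ * m - (⟨ + 3 ⟩ * x + a₂)

  module _ (u a₁ a₂ a₃ a₄ a₆ : Carrier) where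
    c₄ˢ c₆ˢ : Carrier
    c₄ˢ = c₄ (u * a₁) (u * u * a₂) (u * u * u * a₃) (u * u * u * u * a₄) (u * u * u * u * u * u * a₆)
    c₆ˢ = c₆ (u * a₁) (u * u * a₂) (u * u * u * a₃) (u * u * u * u * a₄) (u * u * u * u * u * u * a₆)

  module _ (r s t a₁ a₂ a₃ a₄ a₆ : Carrier) where
    a₁ᵗ a₂ᵗ a₃ᵗ a₄ᵗ a₆ᵗ c₄ᵗ c₆ᵗ : Carrier
    a₁ᵗ = a₁ + ⟨ + 2 ⟩ * s
    a₂ᵗ = a₂ - s * a₁ + ⟨ + 3 ⟩ * r - s * s
    a₃ᵗ = a₃ + r * a₁ + ⟨ + 2 ⟩ * t
    a₄ᵗ = a₄ - s * a₃ + ⟨ + 2 ⟩ * r * a₂ - (t + r * s) * a₁ + ⟨ + 3 ⟩ * r * r - ⟨ + 2 ⟩ * s * t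
    a₆ᵗ = a₆ + r * a₄ + r * r * a₂ + r * r * r - t * a₃ - t * t - r * t * a₁
    c₄ᵗ = c₄ a₁ᵗ a₂ᵗ a₃ᵗ a₄ᵗ a₆ᵗ
    c₆ᵗ = c₆ a₁ᵗ a₂ᵗ a₃ᵗ a₄ᵗ a₆ᵗ

module WeierstrassFormulasHomomorphism
  (R S : RawRing 0ℓ 0ℓ) (⟨_⟩ᴿ : ℤ → RawRing.Carrier R) (⟨_⟩ˢ : ℤ → RawRing.Carrier S)
  (f : RawRing.Carrier R → RawRing.Carrier S)
  (f-+ : ∀ x y → f (RawRing._+_ R x y) ≡ RawRing._+_ S (f x) (f y))
  (f-* : ∀ x y → f (RawRing._*_ R x y) ≡ RawRing._*_ S (f x) (f y))
  (f-- : ∀ x → f (RawRing.-_ R x) ≡ RawRing.-_ S (f x))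
  (f-⟨⟩ : ∀ k → f ⟨ k ⟩ᴿ ≡ ⟨ k ⟩ˢ)
  where
  private
    module R = WeierstrassFormulas R ⟨_⟩ᴿ
    module S = WeierstrassFormulas S ⟨_⟩ˢ
    open RawRing
    variable
      x y : Carrier R
      X Y : Carrier S
    infixl 6 _⊕_ _⊖_
    infixl 7 _⊛_
    infix  8 ⊝_
    _⊕_ : f x ≡ X → f y ≡ Y → f (_+_ R x y) ≡ _+_ S X Y
    _⊕_ {x} {y = y} p q = trans (f-+ x y) (cong₂ (_+_ S) p q)
    _⊛_ : f x ≡ X → f y ≡ Y → f (_*_ R x y) ≡ _*_ S X Y
    _⊛_ {x} {y = y} p q = trans (f-* x y) (cong₂ (_*_ S) p q)
    ⊝_ : f x ≡ X → f (-_ R x) ≡ -_ S X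
    ⊝_ {x} p = trans (f-- x) (cong (-_ S) p)
    _⊖_ : f x ≡ X → f y ≡ Y → f (x R.- y) ≡ X S.- Y
    p ⊖ q = p ⊕ ⊝ q
    ⟨⟩ : ∀ {k} → f ⟨ k ⟩ᴿ ≡ ⟨ k ⟩ˢ
    ⟨⟩ {k} = f-⟨⟩ k

  module _ (a₁ a₂ a₃ a₄ a₆ : Carrier R) where
    private
      f-b₂ : f (R.b₂ a₁ a₂ a₃ a₄ a₆) ≡ S.b₂ (f a₁) (f a₂) (f a₃) (f a₄) (f a₆)
      f-b₂ = refl ⊛ refl ⊕ ⟨⟩ ⊛ refl
      f-b₄ : f (R.b₄ a₁ a₂ a₃ a₄ a₆) ≡ S.b₄ (f a₁) (f a₂) (f a₃) (f a₄) (f a₆)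
      f-b₄ = ⟨⟩ ⊛ refl ⊕ refl ⊛ refl
      f-b₆ : f (R.b₆ a₁ a₂ a₃ a₄ a₆) ≡ S.b₆ (f a₁) (f a₂) (f a₃) (f a₄) (f a₆)
      f-b₆ = refl ⊛ refl ⊕ ⟨⟩ ⊛ refl
      f-b₈ : f (R.b₈ a₁ a₂ a₃ a₄ a₆) ≡ S.b₈ (f a₁) (f a₂) (f a₃) (f a₄) (f a₆)
      f-b₈ = refl ⊛ refl ⊛ refl ⊕ ⟨⟩ ⊛ refl ⊛ refl ⊖ refl ⊛ refl ⊛ refl ⊕ refl ⊛ refl ⊛ refl ⊖ refl ⊛ refl

    f-c₄ : f (R.c₄ a₁ a₂ a₃ a₄ a₆) ≡ S.c₄ (f a₁) (f a₂) (f a₃) (f a₄) (f a₆)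
    f-c₄ = f-b₂ ⊛ f-b₂ ⊖ ⟨⟩ ⊛ f-b₄

    f-Δ : f (R.Δ′ a₁ a₂ a₃ a₄ a₆) ≡ S.Δ′ (f a₁) (f a₂) (f a₃) (f a₄) (f a₆)
    f-Δ = ⊝ (f-b₂ ⊛ f-b₂ ⊛ f-b₈) ⊖ ⟨⟩ ⊛ (f-b₄ ⊛ f-b₄ ⊛ f-b₄) ⊖ ⟨⟩ ⊛ (f-b₆ ⊛ f-b₆) ⊕ ⟨⟩ ⊛ (f-b₂ ⊛ f-b₄ ⊛ f-b₆)

module ℤW = WeierstrassFormulas ℤ.+-*-rawRing id
module ℚW = WeierstrassFormulas Q.+-*-rawRing ⟦_⟧

ℤPolynomialRawRing : ℕ → RawRing 0ℓ 0ℓ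
ℤPolynomialRawRing n = record
  { Carrier = Polynomial n ; _≈_ = _≡_ ; _+_ = _:+_ ; _*_ = _:*_ ; -_ = :-_ ; 0# = con (+ 0) ; 1# = con (+ 1) }
  where open ℤSolver.+-*-Solver

ℚPolynomialRawRing : ℕ → RawRing 0ℓ 0ℓ
ℚPolynomialRawRing n = record
  { Carrier = Polynomial n ; _≈_ = _≡_ ; _+_ = _:+_ ; _*_ = _:*_ ; -_ = :-_ ; 0# = con Q.0ℚ ; 1# = con Q.1ℚ }
  where open QSolver.+-*-Solver

module ℤPolyW {n} = WeierstrassFormulas (ℤPolynomialRawRing n) ℤSolver.+-*-Solver.con
module ℚPolyW {n} = WeierstrassFormulas (ℚPolynomialRawRing n) (QSolver.+-*-Solver.con ∘ ⟦_⟧)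

private
  k : ∀ {n} → ℤ → QSolver.+-*-Solver.Polynomial n
  k = QSolver.+-*-Solver.con ∘ ⟦_⟧

open WeierstrassFormulasHomomorphism ℤ.+-*-rawRing Q.+-*-rawRing id ⟦_⟧ ⟦_⟧ ⟦⟧-+ ⟦⟧-* ⟦⟧-neg (λ _ → refl)
  renaming (f-c₄ to ⟦⟧-c₄; f-Δ to ⟦⟧-Δ)

c₄ : WModel → ℤ
c₄ E = ℤW.c₄ (a1 E) (a2 E) (a3 E) (a4 E) (a6 E)

⟦c₄⟧ : ∀ E → ⟦ c₄ E ⟧ ≡ ℚW.c₄ ⟦ a1 E ⟧ ⟦ a2 E ⟧ ⟦ a3 E ⟧ ⟦ a4 E ⟧ ⟦ a6 E ⟧
⟦c₄⟧ E = ⟦⟧-c₄ (a1 E) (a2 E) (a3 E) (a4 E) (a6 E)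

-- going through Δ≡ℤWΔ′ keeps Agda from unfolding ⟦_⟧ when comparing the two sides
⟦Δ⟧ : ∀ E → ⟦ Δ E ⟧ ≡ ℚW.Δ′ ⟦ a1 E ⟧ ⟦ a2 E ⟧ ⟦ a3 E ⟧ ⟦ a4 E ⟧ ⟦ a6 E ⟧
⟦Δ⟧ E = trans (cong ⟦_⟧ Δ≡ℤWΔ′) (⟦⟧-Δ (a1 E) (a2 E) (a3 E) (a4 E) (a6 E))
  where
  Δ≡ℤWΔ′ : Δ E ≡ ℤW.Δ′ (a1 E) (a2 E) (a3 E) (a4 E) (a6 E)
  Δ≡ℤWΔ′ = refl

-- Invariants under isomorphism, and minimality

module _ where
  open import Data.Rational using (_+_; _*_; _-_; _/_)
  open Exp (CommutativeRing.commutativeSemiring QP.+-*-commutativeRing) using (_^_)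
  open QSolver.+-*-Solver using (solve; _:=_; con; _:+_; _:*_; _:-_; _:^_)

  b₈≡ : ∀ a₁ a₂ a₃ a₄ a₆ → ℚW.b₈ a₁ a₂ a₃ a₄ a₆
      ≡ + 1 / 4 * (ℚW.b₂ a₁ a₂ a₃ a₄ a₆ * ℚW.b₆ a₁ a₂ a₃ a₄ a₆ - ℚW.b₄ a₁ a₂ a₃ a₄ a₆ * ℚW.b₄ a₁ a₂ a₃ a₄ a₆)
  b₈≡ = solve 5 (λ a₁ a₂ a₃ a₄ a₆ → ℚPolyW.b₈ a₁ a₂ a₃ a₄ a₆
      := con (+ 1 / 4) :* (ℚPolyW.b₂ a₁ a₂ a₃ a₄ a₆ :* ℚPolyW.b₆ a₁ a₂ a₃ a₄ a₆ :- ℚPolyW.b₄ a₁ a₂ a₃ a₄ a₆ :* ℚPolyW.b₄ a₁ a₂ a₃ a₄ a₆)) refl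

  Δᵇ≡ : ∀ b₂ b₄ b₆ → ℚW.Δᵇ b₂ b₄ b₆ (+ 1 / 4 * (b₂ * b₆ - b₄ * b₄))
      ≡ + 1 / 1728 * (ℚW.c₄ᵇ b₂ b₄ ^ 3 - ℚW.c₆ᵇ b₂ b₄ b₆ ^ 2)
  Δᵇ≡ = solve 3 (λ b₂ b₄ b₆ → ℚPolyW.Δᵇ b₂ b₄ b₆ (con (+ 1 / 4) :* (b₂ :* b₆ :- b₄ :* b₄))
      := con (+ 1 / 1728) :* (ℚPolyW.c₄ᵇ b₂ b₄ :^ 3 :- ℚPolyW.c₆ᵇ b₂ b₄ b₆ :^ 2)) refl

  Δ≡[c₄³-c₆²]/1728 : ∀ a₁ a₂ a₃ a₄ a₆ → ℚW.Δ′ a₁ a₂ a₃ a₄ a₆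
    ≡ + 1 / 1728 * (ℚW.c₄ a₁ a₂ a₃ a₄ a₆ ^ 3 - ℚW.c₆ a₁ a₂ a₃ a₄ a₆ ^ 2)
  Δ≡[c₄³-c₆²]/1728 a₁ a₂ a₃ a₄ a₆ =
    trans (cong (ℚW.Δᵇ b₂′ b₄′ b₆′) (b₈≡ a₁ a₂ a₃ a₄ a₆)) (Δᵇ≡ b₂′ b₄′ b₆′)
    where
    b₂′ = ℚW.b₂ a₁ a₂ a₃ a₄ a₆
    b₄′ = ℚW.b₄ a₁ a₂ a₃ a₄ a₆
    b₆′ = ℚW.b₆ a₁ a₂ a₃ a₄ a₆

  c₄-scale : ∀ u a₁ a₂ a₃ a₄ a₆ → ℚW.c₄ˢ u a₁ a₂ a₃ a₄ a₆ ≡ u ^ 4 * ℚW.c₄ a₁ a₂ a₃ a₄ a₆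
  c₄-scale = solve 6 (λ u a₁ a₂ a₃ a₄ a₆ → ℚPolyW.c₄ˢ u a₁ a₂ a₃ a₄ a₆ := u :^ 4 :* ℚPolyW.c₄ a₁ a₂ a₃ a₄ a₆) refl

  c₆-scale : ∀ u a₁ a₂ a₃ a₄ a₆ → ℚW.c₆ˢ u a₁ a₂ a₃ a₄ a₆ ≡ u ^ 6 * ℚW.c₆ a₁ a₂ a₃ a₄ a₆
  c₆-scale = solve 6 (λ u a₁ a₂ a₃ a₄ a₆ → ℚPolyW.c₆ˢ u a₁ a₂ a₃ a₄ a₆ := u :^ 6 :* ℚPolyW.c₆ a₁ a₂ a₃ a₄ a₆) refl

  c₄-translate : ∀ r s t a₁ a₂ a₃ a₄ a₆ → ℚW.c₄ᵗ r s t a₁ a₂ a₃ a₄ a₆ ≡ ℚW.c₄ a₁ a₂ a₃ a₄ a₆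
  c₄-translate = solve 8 (λ r s t a₁ a₂ a₃ a₄ a₆ → ℚPolyW.c₄ᵗ r s t a₁ a₂ a₃ a₄ a₆ := ℚPolyW.c₄ a₁ a₂ a₃ a₄ a₆) refl

  c₆-translate : ∀ r s t a₁ a₂ a₃ a₄ a₆ → ℚW.c₆ᵗ r s t a₁ a₂ a₃ a₄ a₆ ≡ ℚW.c₆ a₁ a₂ a₃ a₄ a₆
  c₆-translate = solve 8 (λ r s t a₁ a₂ a₃ a₄ a₆ → ℚPolyW.c₆ᵗ r s t a₁ a₂ a₃ a₄ a₆ := ℚPolyW.c₆ a₁ a₂ a₃ a₄ a₆) refl

  cong₅ : ∀ {A B : Set} (f : A → A → A → A → A → B) {x₁ x₂ x₃ x₄ x₅ y₁ y₂ y₃ y₄ y₅} →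
    x₁ ≡ y₁ → x₂ ≡ y₂ → x₃ ≡ y₃ → x₄ ≡ y₄ → x₅ ≡ y₅ → f x₁ x₂ x₃ x₄ x₅ ≡ f y₁ y₂ y₃ y₄ y₅
  cong₅ f refl refl refl refl refl = refl

  ≅ℚ⇒scaled-c₄-Δ : ∀ {E E′} → E ≅ℚ E′ →
    ∃[ u ] (u ^ 4 * ⟦ c₄ E′ ⟧ ≡ ⟦ c₄ E ⟧ × u ^ 12 * ⟦ Δ E′ ⟧ ≡ ⟦ Δ E ⟧)
  ≅ℚ⇒scaled-c₄-Δ {E} {E′} (u , r , s , t , _ , e₁ , e₂ , e₃ , e₄ , e₆) = u , c₄-eq , Δ-eq
    where
    open ≡-Reasoning
    α₁ = ⟦ a1 E ⟧ ; α₂ = ⟦ a2 E ⟧ ; α₃ = ⟦ a3 E ⟧ ; α₄ = ⟦ a4 E ⟧ ; α₆ = ⟦ a6 E ⟧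
    β₁ = ⟦ a1 E′ ⟧ ; β₂ = ⟦ a2 E′ ⟧ ; β₃ = ⟦ a3 E′ ⟧ ; β₄ = ⟦ a4 E′ ⟧ ; β₆ = ⟦ a6 E′ ⟧
    C₄ = ℚW.c₄ α₁ α₂ α₃ α₄ α₆ ; C₆ = ℚW.c₆ α₁ α₂ α₃ α₄ α₆
    C₄′ = ℚW.c₄ β₁ β₂ β₃ β₄ β₆ ; C₆′ = ℚW.c₆ β₁ β₂ β₃ β₄ β₆

    c₄-inv : u ^ 4 * C₄′ ≡ C₄
    c₄-inv = begin
      u ^ 4 * C₄′                    ≡⟨ c₄-scale u β₁ β₂ β₃ β₄ β₆ ⟨
      ℚW.c₄ˢ u β₁ β₂ β₃ β₄ β₆        ≡⟨ cong₅ ℚW.c₄ e₁ e₂ e₃ e₄ e₆ ⟩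
      ℚW.c₄ᵗ r s t α₁ α₂ α₃ α₄ α₆    ≡⟨ c₄-translate r s t α₁ α₂ α₃ α₄ α₆ ⟩
      C₄                             ∎

    c₆-inv : u ^ 6 * C₆′ ≡ C₆
    c₆-inv = begin
      u ^ 6 * C₆′                    ≡⟨ c₆-scale u β₁ β₂ β₃ β₄ β₆ ⟨
      ℚW.c₆ˢ u β₁ β₂ β₃ β₄ β₆        ≡⟨ cong₅ ℚW.c₆ e₁ e₂ e₃ e₄ e₆ ⟩
      ℚW.c₆ᵗ r s t α₁ α₂ α₃ α₄ α₆    ≡⟨ c₆-translate r s t α₁ α₂ α₃ α₄ α₆ ⟩
      C₆                             ∎

    c₄-eq : u ^ 4 * ⟦ c₄ E′ ⟧ ≡ ⟦ c₄ E ⟧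
    c₄-eq = trans (cong (u ^ 4 *_) (⟦c₄⟧ E′)) (trans c₄-inv (sym (⟦c₄⟧ E)))

    Δ-eq : u ^ 12 * ⟦ Δ E′ ⟧ ≡ ⟦ Δ E ⟧
    Δ-eq = begin
      u ^ 12 * ⟦ Δ E′ ⟧
        ≡⟨ cong (u ^ 12 *_) (trans (⟦Δ⟧ E′) (Δ≡[c₄³-c₆²]/1728 β₁ β₂ β₃ β₄ β₆)) ⟩
      u ^ 12 * (+ 1 / 1728 * (C₄′ ^ 3 - C₆′ ^ 2))
        ≡⟨ weights u C₄′ C₆′ ⟩
      + 1 / 1728 * ((u ^ 4 * C₄′) ^ 3 - (u ^ 6 * C₆′) ^ 2)
        ≡⟨ cong₂ (λ x y → + 1 / 1728 * (x ^ 3 - y ^ 2)) c₄-inv c₆-inv ⟩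
      + 1 / 1728 * (C₄ ^ 3 - C₆ ^ 2)
        ≡⟨ trans (⟦Δ⟧ E) (Δ≡[c₄³-c₆²]/1728 α₁ α₂ α₃ α₄ α₆) ⟨
      ⟦ Δ E ⟧ ∎
      where
      weights : ∀ u x y → u ^ 12 * (+ 1 / 1728 * (x ^ 3 - y ^ 2))
                        ≡ + 1 / 1728 * ((u ^ 4 * x) ^ 3 - (u ^ 6 * y) ^ 2)
      weights = solve 3 (λ u x y → u :^ 12 :* (con (+ 1 / 1728) :* (x :^ 3 :- y :^ 2))
                        := con (+ 1 / 1728) :* ((u :^ 4 :* x) :^ 3 :- (u :^ 6 :* y) :^ 2)) refl

  ≅ℚ-refl : ∀ E → E ≅ℚ E
  ≅ℚ-refl E = ⟦ + 1 ⟧ , ⟦ + 0 ⟧ , ⟦ + 0 ⟧ , ⟦ + 0 ⟧ , (λ ()) ,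
    e₁ α₁ α₂ α₃ α₄ α₆ , e₂ α₁ α₂ α₃ α₄ α₆ , e₃ α₁ α₂ α₃ α₄ α₆ , e₄ α₁ α₂ α₃ α₄ α₆ , e₆ α₁ α₂ α₃ α₄ α₆
    where
    α₁ = ⟦ a1 E ⟧ ; α₂ = ⟦ a2 E ⟧ ; α₃ = ⟦ a3 E ⟧ ; α₄ = ⟦ a4 E ⟧ ; α₆ = ⟦ a6 E ⟧
    e₁ = solve 5 (λ a₁ a₂ a₃ a₄ a₆ → (k (+ 1)) :* a₁ := ℚPolyW.a₁ᵗ (k (+ 0)) (k (+ 0)) (k (+ 0)) a₁ a₂ a₃ a₄ a₆) refl
    e₂ = solve 5 (λ a₁ a₂ a₃ a₄ a₆ → (k (+ 1)) :* (k (+ 1)) :* a₂ := ℚPolyW.a₂ᵗ (k (+ 0)) (k (+ 0)) (k (+ 0)) a₁ a₂ a₃ a₄ a₆) refl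
    e₃ = solve 5 (λ a₁ a₂ a₃ a₄ a₆ → (k (+ 1)) :* (k (+ 1)) :* (k (+ 1)) :* a₃ := ℚPolyW.a₃ᵗ (k (+ 0)) (k (+ 0)) (k (+ 0)) a₁ a₂ a₃ a₄ a₆) refl
    e₄ = solve 5 (λ a₁ a₂ a₃ a₄ a₆ → (k (+ 1)) :* (k (+ 1)) :* (k (+ 1)) :* (k (+ 1)) :* a₄ := ℚPolyW.a₄ᵗ (k (+ 0)) (k (+ 0)) (k (+ 0)) a₁ a₂ a₃ a₄ a₆) refl
    e₆ = solve 5 (λ a₁ a₂ a₃ a₄ a₆ → (k (+ 1)) :* (k (+ 1)) :* (k (+ 1)) :* (k (+ 1)) :* (k (+ 1)) :* (k (+ 1)) :* a₆ := ℚPolyW.a₆ᵗ (k (+ 0)) (k (+ 0)) (k (+ 0)) a₁ a₂ a₃ a₄ a₆) refl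

minimalAt-of-∤c₄ : ∀ {ℓ} E → Prime ℓ → ℓ ∤ ℤ.∣ c₄ E ∣ → MinimalAt ℓ E
minimalAt-of-∤c₄ {ℓ} E ℓ-prime ℓ∤c₄ E′ E≅E′ k = minimal (≅ℚ⇒scaled-c₄-Δ {E} {E′} E≅E′)
  where
  open Exp (CommutativeRing.commutativeSemiring QP.+-*-commutativeRing) using (_^_)
  minimal : ∃[ u ] (u ^ 4 Q.* ⟦ c₄ E′ ⟧ ≡ ⟦ c₄ E ⟧ × u ^ 12 Q.* ⟦ Δ E′ ⟧ ≡ ⟦ Δ E ⟧) →
            ℓ ℕ.^ k ∣ ℤ.∣ Δ E ∣ → ℓ ℕ.^ k ∣ ℤ.∣ Δ E′ ∣
  minimal (u@(mkℚ _ _ n⊥d) , c₄-eq , Δ-eq) =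
    prime-power-∣-cross-multiplied ℤ.∣ ↥ u ∣ (↧ₙ u) ℤ.∣ Δ E ∣ ℤ.∣ Δ E′ ∣ 12 ℓ-prime
      (prime∤-cross-multiplied ℤ.∣ ↥ u ∣ (↧ₙ u) ℤ.∣ c₄ E ∣ ℤ.∣ c₄ E′ ∣ ℓ-prime
        (Coprimality.recompute n⊥d) (scaled⇒cross-multiplied u 4 (c₄ E′) (c₄ E) c₄-eq) ℓ∤c₄)
      (scaled⇒cross-multiplied u 12 (Δ E′) (Δ E) Δ-eq) k

minimalAt-of-∤Δ : ∀ {ℓ} E → ℓ ∤ ℤ.∣ Δ E ∣ → MinimalAt ℓ E
minimalAt-of-∤Δ E ℓ∤Δ E′ _ zero    _    = 1∣ ℤ.∣ Δ E′ ∣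
minimalAt-of-∤Δ {ℓ} E ℓ∤Δ E′ _ (suc k) ℓᵏ⁺¹∣Δ = contradiction (∣-trans (m∣m*n (ℓ ℕ.^ k)) ℓᵏ⁺¹∣Δ) ℓ∤Δ

-- y² = x(x + 1)(x + A)
E[_] : ℤ → WModel
E[ A ] = mkW (+ 0) (+ 1 ℤ.+ A) (+ 0) A (+ 0)

-- y² + xy = x³ + 8Yx² + 2Yx, obtained from E[ 32Y ] by x = 4x′, y = 8y′ + 4x′
E₂[_] : ℤ → WModel
E₂[ Y ] = mkW (+ 1) (+ 8 ℤ.* Y) (+ 0) (+ 2 ℤ.* Y) (+ 0)

module _ where
  open import Data.Rational using (_+_; _*_)
  open QSolver.+-*-Solver using (solve; _:=_; _:+_; _:*_)

  E[]≅ℚE₂[] : ∀ Y → E[ + 32 ℤ.* Y ] ≅ℚ E₂[ Y ]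
  E[]≅ℚE₂[] Y = ⟦ + 2 ⟧ , ⟦ + 0 ⟧ , ⟦ + 1 ⟧ , ⟦ + 0 ⟧ , (λ ()) , refl ,
    via (λ a₂ a₄ → ℚW.a₂ᵗ ⟦ + 0 ⟧ ⟦ + 1 ⟧ ⟦ + 0 ⟧ ⟦ + 0 ⟧ a₂ ⟦ + 0 ⟧ a₄ ⟦ + 0 ⟧)
      (trans (cong (⟦ + 2 ⟧ * ⟦ + 2 ⟧ *_) (⟦⟧-* (+ 8) Y))
             (solve 1 (λ y → (k (+ 2)) :* (k (+ 2)) :* (k (+ 8) :* y)
               := ℚPolyW.a₂ᵗ (k (+ 0)) (k (+ 1)) (k (+ 0)) (k (+ 0)) (k (+ 1) :+ (k (+ 32)) :* y) (k (+ 0)) (k (+ 32) :* y) (k (+ 0))) refl y)) ,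
    refl ,
    via (λ a₂ a₄ → ℚW.a₄ᵗ ⟦ + 0 ⟧ ⟦ + 1 ⟧ ⟦ + 0 ⟧ ⟦ + 0 ⟧ a₂ ⟦ + 0 ⟧ a₄ ⟦ + 0 ⟧)
      (trans (cong (⟦ + 2 ⟧ * ⟦ + 2 ⟧ * ⟦ + 2 ⟧ * ⟦ + 2 ⟧ *_) (⟦⟧-* (+ 2) Y))
             (solve 1 (λ y → (k (+ 2)) :* (k (+ 2)) :* (k (+ 2)) :* (k (+ 2)) :* (k (+ 2) :* y)
               := ℚPolyW.a₄ᵗ (k (+ 0)) (k (+ 1)) (k (+ 0)) (k (+ 0)) (k (+ 1) :+ (k (+ 32)) :* y) (k (+ 0)) (k (+ 32) :* y) (k (+ 0))) refl y)) ,
    solve 2 (λ a₂ a₄ → (k (+ 2)) :* (k (+ 2)) :* (k (+ 2)) :* (k (+ 2)) :* (k (+ 2)) :* (k (+ 2)) :* (k (+ 0))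
      := ℚPolyW.a₆ᵗ (k (+ 0)) (k (+ 1)) (k (+ 0)) (k (+ 0)) a₂ (k (+ 0)) a₄ (k (+ 0))) refl ⟦ + 1 ℤ.+ + 32 ℤ.* Y ⟧ ⟦ + 32 ℤ.* Y ⟧
    where
    y = ⟦ Y ⟧
    via : ∀ {lhs} (f : ℚ → ℚ → ℚ) → lhs ≡ f (⟦ + 1 ⟧ + ⟦ + 32 ⟧ * y) (⟦ + 32 ⟧ * y) →
          lhs ≡ f ⟦ + 1 ℤ.+ + 32 ℤ.* Y ⟧ ⟦ + 32 ℤ.* Y ⟧
    via f eq = trans eq (sym (cong₂ f (trans (⟦⟧-+ (+ 1) (+ 32 ℤ.* Y)) (cong (_+_ ⟦ + 1 ⟧) (⟦⟧-* (+ 32) Y)))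
                                     (⟦⟧-* (+ 32) Y)))

module _ {p : ℕ} (X : ℤ) (p∣X : + p ∣ᶻ X) where

  ∣ᶻ-multiple : ∀ {e} k → e ≡ k ℤ.* X → + p ∣ᶻ e
  ∣ᶻ-multiple k refl = ℤ∣.∣⇒∣ᵤ (ℤ∣.∣n⇒∣m*n k (ℤ∣.∣ᵤ⇒∣ {+ p} p∣X))

  ∣ᶻ-offset : ∀ {e} k c → e ≡ k ℤ.* X ℤ.+ c → + p ∣ᶻ e → + p ∣ᶻ c
  ∣ᶻ-offset k c refl p∣e = ℤ∣.∣⇒∣ᵤ (ℤ∣.∣m+n∣m⇒∣n (ℤ∣.∣ᵤ⇒∣ {+ p} p∣e) (ℤ∣.∣n⇒∣m*n k (ℤ∣.∣ᵤ⇒∣ {+ p} p∣X)))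

∣m*m+1∣ : ∀ m → ℤ.∣ m ℤ.* m ℤ.+ + 1 ∣ ≡ ℤ.∣ m ∣ ℕ.* ℤ.∣ m ∣ ℕ.+ 1
∣m*m+1∣ (+ k)    = cong (λ z → ℤ.∣ z ℤ.+ + 1 ∣) (sym (ℤP.pos-* k k))
∣m*m+1∣ -[1+ k ] = refl

module _ where
  open ℤSolver.+-*-Solver using (solve; _:=_; con; Polynomial; _:+_; _:*_; _:-_; :-_)
  open import Data.Integer using (_+_; _*_; _-_; -_)

  private
    e[] : ∀ {k} {B : Set} → (Polynomial k → Polynomial k → Polynomial k → Polynomial k → Polynomial k → B) → Polynomial k → B
    e[] f X = f (con (+ 0)) (con (+ 1) :+ (con (+ 1) :+ X)) (con (+ 0)) (con (+ 1) :+ X) (con (+ 0))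

    e₂[] : ∀ {k} {B : Set} → (Polynomial k → Polynomial k → Polynomial k → Polynomial k → Polynomial k → B) → Polynomial k → B
    e₂[] f Y = f (con (+ 1)) (con (+ 8) :* Y) (con (+ 0)) (con (+ 2) :* Y) (con (+ 0))

  Δ-E[] : ∀ X → Δ (E[ + 1 + X ]) ≡ + 16 * (X * X) * ((+ 1 + X) * (+ 1 + X))
  Δ-E[] = solve 1 (λ X → e[] ℤPolyW.Δ′ X
    := con (+ 16) :* (X :* X) :* ((con (+ 1) :+ X) :* (con (+ 1) :+ X))) refl

  ∣Δ-E[]∣ : ∀ n → ℤ.∣ Δ (E[ + suc n ]) ∣ ≡ 16 ℕ.* (n ℕ.* n) ℕ.* (suc n ℕ.* suc n)
  ∣Δ-E[]∣ n = trans (cong ℤ.∣_∣ (Δ-E[] (+ n)))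
    (trans (ℤP.abs-* (+ 16 * (+ n * + n)) (+ suc n * + suc n))
      (cong₂ ℕ._*_ (trans (ℤP.abs-* (+ 16) (+ n * + n)) (cong (16 ℕ.*_) (ℤP.abs-* (+ n) (+ n))))
                   (ℤP.abs-* (+ suc n) (+ suc n))))

  goodReduction-E[] : ∀ {ℓ} n → Prime ℓ → ℓ ∤ 2 → ℓ ∤ n → ℓ ∤ suc n →
    GoodReduction ℓ (E[ + suc n ])
  goodReduction-E[] {ℓ} n ℓ-prime ℓ∤2 ℓ∤n ℓ∤1+n = E , ≅ℚ-refl E , minimalAt-of-∤Δ E ℓ∤Δ , ℓ∤Δ
    where
    E = E[ + suc n ]
    ℓ∤Δ : ℓ ∤ ℤ.∣ Δ E ∣
    ℓ∤Δ = subst (ℓ ∤_) (sym (∣Δ-E[]∣ n))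
      (prime∤* ℓ-prime (prime∤* ℓ-prime (ℓ∤2 ∘ prime∣^⇒∣ ℓ-prime 2 4) (prime∤* ℓ-prime ℓ∤n ℓ∤n))
                       (prime∤* ℓ-prime ℓ∤1+n ℓ∤1+n))

  nonSplitMultiplicative-E[] : ∀ {p} g n → Prime p → p ≡ 4 ℕ.* g ℕ.+ 3 → p ∣ n →
    NonSplitMultiplicative p (E[ + suc n ])
  nonSplitMultiplicative-E[] {p} g n p-prime p≡4g+3 p∣n =
    E , ≅ℚ-refl E , minimalAt-of-∤c₄ E p-prime p∤c₄ ,
    -[1+ 0 ] , + 0 , ((F≡0 , ∂ₓF≡0 , ∂ᵧF≡0) , node) , irrational-tangents
    where
    E = E[ + suc n ]
    X = + n
    p∤2ᵏ : ∀ k → p ∤ 2 ℕ.^ k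
    p∤2ᵏ k = (λ p∣2 → <⇒≱ (subst (2 <_) (sym p≡4g+3) (m≤n+m 3 (4 ℕ.* g))) (∣⇒≤ p∣2))
           ∘ prime∣^⇒∣ p-prime 2 k
    p∤c₄ : p ∤ ℤ.∣ c₄ E ∣
    p∤c₄ = p∤2ᵏ 4 ∘ ∣ᶻ-offset X p∣n (+ 16 * (X + + 1)) (+ 16) (c₄≡ X)
      where
      c₄≡ : ∀ X → c₄ (E[ + 1 + X ]) ≡ + 16 * (X + + 1) * X + + 16
      c₄≡ = solve 1 (λ X → e[] ℤPolyW.c₄ X
        := con (+ 16) :* (X :+ con (+ 1)) :* X :+ con (+ 16)) refl
    F≡0 = ∣ᶻ-multiple X p∣n (+ 0) (solve 1 (λ X → e[] ℤPolyW.F X (:- con (+ 1)) (con (+ 0))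
      := con (+ 0) :* X) refl X)
    ∂ₓF≡0 = ∣ᶻ-multiple X p∣n (+ 1) (solve 1 (λ X → e[] ℤPolyW.∂ₓF X (:- con (+ 1)) (con (+ 0))
      := con (+ 1) :* X) refl X)
    ∂ᵧF≡0 = ∣ᶻ-multiple X p∣n (+ 0) (solve 1 (λ X → e[] ℤPolyW.∂ᵧF X (:- con (+ 1)) (con (+ 0))
      := con (+ 0) :* X) refl X)
    node : ¬ (+ p ∣ᶻ ℤW.tangent-discriminant (+ 0) (+ 1 + (+ 1 + X)) (+ 0) (+ 1 + X) (+ 0) -[1+ 0 ])
    node = p∤2ᵏ 2 ∘ ∣ᶻ-offset X p∣n (+ 4) (- + 4) (solve 1 (λ X → e[] ℤPolyW.tangent-discriminant X (:- con (+ 1))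
      := con (+ 4) :* X :+ :- con (+ 4)) refl X)
    irrational-tangents : ¬ RationalTangents p E -[1+ 0 ]
    irrational-tangents (m , p∣slope) = prime≡3mod4⇒∤m*m+1 g p-prime p≡4g+3 ℤ.∣ m ∣
      (subst (p ∣_) (∣m*m+1∣ m) (∣ᶻ-offset X p∣n (- + 1) (m * m + + 1) (slope≡ X m) p∣slope))
      where
      slope≡ : ∀ X m → ℤW.tangent-slope (+ 0) (+ 1 + (+ 1 + X)) (+ 0) (+ 1 + X) (+ 0) -[1+ 0 ] m
                     ≡ - + 1 * X + (m * m + + 1)
      slope≡ = solve 2 (λ X m → e[] ℤPolyW.tangent-slope X (:- con (+ 1)) m
        := :- con (+ 1) :* X :+ (m :* m :+ con (+ 1))) refl

  splitMultiplicative-E[] : ∀ Y → SplitMultiplicative 2 (E[ + 32 * Y ])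
  splitMultiplicative-E[] Y =
    E₂[ Y ] , E[]≅ℚE₂[] Y , minimalAt-of-∤c₄ (E₂[ Y ]) prime[2] 2∤c₄ ,
    + 0 , + 0 , ((F≡0 , ∂ₓF≡0 , ∂ᵧF≡0) , node) , (+ 0 , slope≡0)
    where
    2∣2 : + 2 ∣ᶻ + 2
    2∣2 = ∣-refl
    2∤1 : 2 ∤ 1
    2∤1 = prime∤1 prime[2]
    2∤c₄ : 2 ∤ ℤ.∣ c₄ (E₂[ Y ]) ∣
    2∤c₄ = 2∤1 ∘ ∣ᶻ-offset (+ 2) 2∣2 (Y * (+ 512 * Y - + 16)) (+ 1) (solve 1 (λ Y → e₂[] ℤPolyW.c₄ Y
      := Y :* (con (+ 512) :* Y :- con (+ 16)) :* con (+ 2) :+ con (+ 1)) refl Y)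
    F≡0 = ∣ᶻ-multiple (+ 2) 2∣2 (+ 0) (solve 1 (λ Y → e₂[] ℤPolyW.F Y (con (+ 0)) (con (+ 0))
      := con (+ 0) :* con (+ 2)) refl Y)
    ∂ₓF≡0 = ∣ᶻ-multiple (+ 2) 2∣2 (- Y) (solve 1 (λ Y → e₂[] ℤPolyW.∂ₓF Y (con (+ 0)) (con (+ 0))
      := :- Y :* con (+ 2)) refl Y)
    ∂ᵧF≡0 = ∣ᶻ-multiple (+ 2) 2∣2 (+ 0) (solve 1 (λ Y → e₂[] ℤPolyW.∂ᵧF Y (con (+ 0)) (con (+ 0))
      := con (+ 0) :* con (+ 2)) refl Y)
    node = 2∤1 ∘ ∣ᶻ-offset (+ 2) 2∣2 (+ 16 * Y) (+ 1) (solve 1 (λ Y → e₂[] ℤPolyW.tangent-discriminant Y (con (+ 0))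
      := con (+ 16) :* Y :* con (+ 2) :+ con (+ 1)) refl Y)
    slope≡0 = ∣ᶻ-multiple (+ 2) 2∣2 (- (+ 4 * Y)) (solve 1 (λ Y → e₂[] ℤPolyW.tangent-slope Y (con (+ 0)) (con (+ 0))
      := :- (con (+ 4) :* Y) :* con (+ 2)) refl Y)

module _ where
  open import Data.Nat using (_+_; _*_; _^_)

  1+n≡4a⇒n≡4[a∸1]+3 : ∀ {n} a → suc n ≡ 4 * a → n ≡ 4 * (a ∸ 1) + 3
  1+n≡4a⇒n≡4[a∸1]+3 (suc b) eq = trans (suc-injective eq) (regroup b)
    where
    regroup : ∀ b → b + 3 * (1 + b) ≡ 4 * b + 3
    regroup = solve-∀

  lemma3p1 : (q : ℕ) → 5 ≤ q → Prime q → Prime (2 ^ q ∸ 1) →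
      SplitMultiplicative 2 (Eq q) ×
      NonSplitMultiplicative (2 ^ q ∸ 1) (Eq q) ×
      ((ℓ : ℕ) → Prime ℓ → ℓ ≢ 2 → ℓ ≢ 2 ^ q ∸ 1 → GoodReduction ℓ (Eq q))
  lemma3p1 q q≥5 _ P-prime = split , nonSplit , good
    where
    P = 2 ^ q ∸ 1
    2^q≡1+P : 2 ^ q ≡ suc P
    2^q≡1+P = sym (m+[n∸m]≡n (m^n>0 2 q))
    2^q≡2^k*2^[q∸k] : ∀ k → k ≤ q → 2 ^ q ≡ 2 ^ k * 2 ^ (q ∸ k)
    2^q≡2^k*2^[q∸k] k k≤q = trans (cong (2 ^_) (sym (m+[n∸m]≡n k≤q))) (^-distribˡ-+-* 2 k (q ∸ k))

    split : SplitMultiplicative 2 (Eq q)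
    split = subst (λ A → SplitMultiplicative 2 E[ A ])
      (sym (trans (cong +_ (2^q≡2^k*2^[q∸k] 5 q≥5)) (ℤP.pos-* 32 (2 ^ (q ∸ 5)))))
      (splitMultiplicative-E[] (+ 2 ^ (q ∸ 5)))

    nonSplit : NonSplitMultiplicative P (Eq q)
    nonSplit = subst (λ A → NonSplitMultiplicative P E[ + A ]) (sym 2^q≡1+P)
      (nonSplitMultiplicative-E[] (2 ^ (q ∸ 2) ∸ 1) P P-prime
        (1+n≡4a⇒n≡4[a∸1]+3 (2 ^ (q ∸ 2)) (trans (sym 2^q≡1+P) (2^q≡2^k*2^[q∸k] 2 (≤-trans (s≤s (s≤s z≤n)) q≥5))))
        ∣-refl)

    good : (ℓ : ℕ) → Prime ℓ → ℓ ≢ 2 → ℓ ≢ P → GoodReduction ℓ (Eq q)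
    good ℓ ℓ-prime ℓ≢2 ℓ≢P = subst (λ A → GoodReduction ℓ E[ + A ]) (sym 2^q≡1+P)
      (goodReduction-E[] P ℓ-prime ℓ∤2 (ℓ≢P ∘ prime∣prime⇒≡ ℓ-prime P-prime)
        (ℓ∤2 ∘ prime∣^⇒∣ ℓ-prime 2 q ∘ subst (ℓ ∣_) (sym 2^q≡1+P)))
      where
      ℓ∤2 : ℓ ∤ 2
      ℓ∤2 = ℓ≢2 ∘ prime∣prime⇒≡ ℓ-prime prime[2]
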